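{- Let $P,Q$ be integers with $4Q\notin\{P^2,0\}$ and suppose that the Lucas sequences $U(P,Q,n)$ and $V(P,Q,n)$ are sequences of natural numbers. Then, for every sufficiently large integer $b\ge 2$, the following identities hold for every integer $n\ge 1$: $$U(P,Q,n)=\left\lfloor \frac{b^{n^2+n}}{b^{2n}-Pb^n+Q}\right\rfloor \bmod b^n,\qquad V(P,Q,n)=\left\lfloor \frac{2b^{n^2+2n}-Pb^{n^2+n}}{b^{2n}-Pb^n+Q}\right\rfloor \bmod b^n .$$
   Context: For integers $P,Q$, $U(P,Q,n)$ is defined by $U(P,Q,0)=0$, $U(P,Q,1)=1$, $U(P,Q,n+2)=PU(P,Q,n+1)-QU(P,Q,n)$, and $V(P,Q,n)$ by $V(P,Q,0)=2$, $V(P,Q,1)=P$ and the same recurrence. Natural numbers are the non-negative integers. For $y\ge1$, $x\bmod y$ is the least non-negative residue of $x$ modulo $y$. -}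

module Defs where

open import Data.Nat as ℕ using (ℕ; zero; suc)
open import Data.Integer as ℤ using (ℤ; +_; -[1+_]; _+_; _-_; _*_; _^_; _/ℕ_; _%ℕ_)

U : ℤ → ℤ → ℕ → ℤ
U P Q zero = + 0
U P Q (suc zero) = + 1
U P Q (suc (suc n)) = P * U P Q (suc n) - Q * U P Q n

V : ℤ → ℤ → ℕ → ℤ
V P Q zero = + 2
V P Q (suc zero) = P
V P Q (suc (suc n)) = P * V P Q (suc n) - Q * V P Q n

-- floor(a / d) for an integer a and a positive integer d (given as + (suc k)).
-- For d ≤ 0 this returns a junk value 0; the statement separately asserts d > 0.
floorDiv : ℤ → ℤ → ℤ
floorDiv a (+ suc k) = a /ℕ suc k
floorDiv a _ = + 0

-- x mod y, least non-negative residue, for y ≥ 1 (junk 0 for y = 0)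
modNat : ℤ → ℕ → ℤ
modNat x zero = + 0
modNat x (suc m) = + (x %ℕ suc m)

module Submission where

-- If W satisfies W (k + 2) = P W (k + 1) - Q W k, then for every integer B the Horner sum
-- S = Σ_{k ≤ n} W k B^(n-k) satisfies
--   W 0 B^(n+2) + (W 1 - P W 0) B^(n+1) = S (B² - P B + Q) + (W (n+1) B - Q W n),
-- the truncation at t = 1/B of Σ W k t^k = (W 0 + (W 1 - P W 0) t) / (1 - P t + Q t²).
-- Since |W k| ≤ 2 M^k with M = 1 + |P| + |Q|, taking B = b^n with b ≥ 5 M² puts the
-- remainder in [0, B² - P B + Q) and W n in [0, B), so the floor of the quotient is S and
-- its last base-B digit is W n. For U and V the numerator is b^(n²+n), resp.
-- 2 b^(n²+2n) - P b^(n²+n).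

open import Defs
open import Data.Nat.Base as ℕ using (ℕ; zero; suc; NonZero)
import Data.Nat.Properties as ℕ
open import Data.List using (_∷_; [])
import Data.Nat.Tactic.RingSolver as ℕ-Solver
open import Data.Product using (Σ; _×_; _,_; proj₁; proj₂)
open import Relation.Binary.PropositionalEquality
open import Algebra.Properties.CommutativeSemigroup ℕ.*-commutativeSemigroup using (x∙yz≈y∙xz)

module _ where
  open import Data.Nat
  open import Data.Nat.Properties
  open import Data.Nat.Divisibility using (n∣m*n)
  open import Data.Nat.DivMod using (+-distrib-/-∣ˡ; %-remove-+ˡ; m*n/n≡m; m<n⇒m/n≡0; m<n⇒m%n≡m)
  open ≤-Reasoning

  [s*d+r]/d≡s : ∀ s r d .{{_ : NonZero d}} → r < d → (s * d + r) / d ≡ s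
  [s*d+r]/d≡s s r d r<d = begin-equality
    (s * d + r) / d   ≡⟨ +-distrib-/-∣ˡ r (n∣m*n s) ⟩
    s * d / d + r / d ≡⟨ cong₂ _+_ (m*n/n≡m s d) (m<n⇒m/n≡0 r<d) ⟩
    s + 0             ≡⟨ +-identityʳ s ⟩
    s                 ∎

  [s*d+r]%d≡r : ∀ s r d .{{_ : NonZero d}} → r < d → (s * d + r) % d ≡ r
  [s*d+r]%d≡r s r d r<d = trans (%-remove-+ˡ r (n∣m*n s)) (m<n⇒m%n≡m r<d)

  a+c<X⇒a*X+c<X*X : ∀ a c {X} → a + c < X → a * X + c < X * X
  a+c<X⇒a*X+c<X*X a c {X} a+c<X = begin-strict
    a * X + c <⟨ +-monoʳ-< (a * X) (≤-<-trans (m≤n+m c a) a+c<X) ⟩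
    a * X + X ≡⟨ +-comm (a * X) X ⟩
    suc a * X ≤⟨ *-monoˡ-≤ X (≤-trans (s≤s (m≤m+n a c)) a+c<X) ⟩
    X * X     ∎

  c*M^[2+m]≤b^[1+m] : ∀ c {M b} .{{_ : NonZero c}} .{{_ : NonZero M}} → c * (M * M) ≤ b →
                      ∀ m → c * M ^ suc (suc m) ≤ b ^ suc m
  c*M^[2+m]≤b^[1+m] c {M} {b} cM²≤b m = begin
    c * (M * (M * M ^ m)) ≡⟨ cong (c *_) (*-assoc M M (M ^ m)) ⟨
    c * (M * M * M ^ m)   ≡⟨ *-assoc c (M * M) (M ^ m) ⟨
    c * (M * M) * M ^ m   ≤⟨ *-mono-≤ cM²≤b (^-monoˡ-≤ m M≤b) ⟩
    b * b ^ m             ∎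
    where
      M≤b : M ≤ b
      M≤b = ≤-trans (≤-trans (m≤m*n M M) (m≤n*m (M * M) c)) cM²≤b

  digit-bounds : ∀ {p q M Y X w₀ w₁} .{{_ : NonZero M}} .{{_ : NonZero Y}} → p + q < M →
                 w₀ ≤ 2 * Y → w₁ ≤ 2 * (M * Y) → 5 * (M * Y) ≤ X →
                 w₀ < X × w₁ + p + q * suc w₀ < X
  digit-bounds {p} {q} {M} {Y} {X} {w₀} {w₁} p+q<M w₀≤ w₁≤ 5MY≤X = w₀<X , rest<X
    where
      w₀<X : w₀ < X
      w₀<X = begin-strict
        w₀          ≤⟨ w₀≤ ⟩
        2 * Y       ≤⟨ *-monoʳ-≤ 2 (m≤n*m Y M) ⟩
        2 * (M * Y) <⟨ *-monoˡ-< (M * Y) {{m*n≢0 M Y}} {2} {5} (s≤s (s≤s (s≤s z≤n))) ⟩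
        5 * (M * Y) ≤⟨ 5MY≤X ⟩
        X           ∎
      q≤M : q ≤ M
      q≤M = ≤-trans (m≤n+m q p) (<⇒≤ p+q<M)
      rest<X : w₁ + p + q * suc w₀ < X
      rest<X = begin-strict
        w₁ + p + q * suc w₀               ≡⟨ ℕ-Solver.solve (w₁ ∷ p ∷ q ∷ w₀ ∷ []) ⟩
        w₁ + q * w₀ + (p + q)             <⟨ +-mono-≤-< (+-mono-≤ w₁≤ (*-mono-≤ q≤M w₀≤))
                                                        (<-≤-trans p+q<M (m≤m*n M Y)) ⟩
        2 * (M * Y) + M * (2 * Y) + M * Y ≡⟨ ℕ-Solver.solve (M ∷ Y ∷ []) ⟩
        5 * (M * Y)                       ≤⟨ 5MY≤X ⟩
        X                                 ∎

open import Data.Integer as ℤ using (ℤ; +_; -[1+_]; _+_; _-_; _*_; _^_; _≤_; _<_; ∣_∣; +≤+; +<+; -≤+)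
import Data.Integer.Properties as ℤ
open import Data.Integer.Tactic.RingSolver using (solve-∀)

i≤+∣i∣ : ∀ i → i ≤ + ∣ i ∣
i≤+∣i∣ (+ n)    = ℤ.≤-refl
i≤+∣i∣ -[1+ n ] = -≤+

charPoly : ℤ → ℤ → ℤ → ℤ
charPoly P Q B = B ^ 2 - P * B + Q

pos-*-+ : ∀ s d r → + (s ℕ.* d ℕ.+ r) ≡ + s * + d + + r
pos-*-+ s d r = trans (ℤ.pos-+ (s ℕ.* d) r) (cong (_+ + r) (ℤ.pos-* s d))

pos-^ : ∀ b n → (+ b) ^ n ≡ + (b ℕ.^ n)
pos-^ b zero    = refl
pos-^ b (suc n) = trans (cong (+ b *_) (pos-^ b n)) (sym (ℤ.pos-* b (b ℕ.^ n)))

pos-^-* : ∀ b n k → (+ b) ^ (n ℕ.* k) ≡ (+ (b ℕ.^ n)) ^ k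
pos-^-* b n k = trans (sym (ℤ.^-*-assoc (+ b) n k)) (cong (_^ k) (pos-^ b n))

floorDiv-quotient : ∀ {a D s r} → a ≡ s * D + r → + 0 ≤ s → + 0 ≤ r → r < D → floorDiv a D ≡ s
floorDiv-quotient {D = + suc d} {+ s} {+ r} refl _ _ (+<+ r<D)
  rewrite sym (pos-*-+ s (suc d) r) = cong +_ ([s*d+r]/d≡s s r (suc d) r<D)

modNat-digit : ∀ {s w} X → + 0 ≤ s → + 0 ≤ w → w < + X → modNat (s * + X + w) X ≡ w
modNat-digit {+ s} {+ w} (suc x) _ _ (+<+ w<X)
  rewrite sym (pos-*-+ s (suc x) w) = cong +_ ([s*d+r]%d≡r s w (suc x) w<X)

remainder-nonneg : ∀ P Q x y X → + 0 ≤ x → + 0 ≤ P * x - Q * y → ∣ Q ∣ ℕ.* ∣ y ∣ ℕ.≤ X →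
                   + 0 ≤ x * + X - Q * y
-- For x = 0 the remainder -Q y is the next term of the recurrence.
remainder-nonneg P Q (+ zero)  y X _ next≥0 _ =
  subst (λ t → + 0 ≤ t - Q * y) (ℤ.*-zeroʳ P) next≥0
remainder-nonneg P Q (+ suc k) y X _ _ ∣Qy∣≤X = begin
  + 0                       ≤⟨ ℤ.i≤j⇒0≤j-i (+≤+ ∣Qy∣≤X) ⟩
  + X - + (∣ Q ∣ ℕ.* ∣ y ∣) ≡⟨ cong (λ t → + X - + t) (ℤ.abs-* Q y) ⟨
  + X - + ∣ Q * y ∣         ≤⟨ ℤ.+-mono-≤ X≤[1+k]X (ℤ.neg-mono-≤ (i≤+∣i∣ (Q * y))) ⟩
  + suc k * + X - Q * y     ∎
  where
    open ℤ.≤-Reasoning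
    X≤[1+k]X : + X ≤ + suc k * + X
    X≤[1+k]X = ℤ.≤-trans (+≤+ (ℕ.m≤m+n X (k ℕ.* X))) (ℤ.≤-reflexive (ℤ.pos-* (suc k) X))

∣xX+PX-Qy-Q∣<X*X : ∀ P Q x y X → ∣ x ∣ ℕ.+ ∣ P ∣ ℕ.+ ∣ Q ∣ ℕ.* suc ∣ y ∣ ℕ.< X →
                    ∣ x * + X + P * + X - Q * y - Q ∣ ℕ.< X ℕ.* X
∣xX+PX-Qy-Q∣<X*X P Q x y X bound = begin-strict
  ∣ x * + X + P * + X - Q * y - Q ∣                   ≤⟨ ℤ.∣i-j∣≤∣i∣+∣j∣ (x * + X + P * + X - Q * y) Q ⟩
  ∣ x * + X + P * + X - Q * y ∣ ℕ.+ ∣ Q ∣              ≤⟨ ℕ.+-monoˡ-≤ (∣ Q ∣) (ℤ.∣i-j∣≤∣i∣+∣j∣ (x * + X + P * + X) (Q * y)) ⟩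
  ∣ x * + X + P * + X ∣ ℕ.+ ∣ Q * y ∣ ℕ.+ ∣ Q ∣        ≤⟨ ℕ.+-monoˡ-≤ (∣ Q ∣)
                                                          (ℕ.+-monoˡ-≤ (∣ Q * y ∣) (ℤ.∣i+j∣≤∣i∣+∣j∣ (x * + X) (P * + X))) ⟩
  ∣ x * + X ∣ ℕ.+ ∣ P * + X ∣ ℕ.+ ∣ Q * y ∣ ℕ.+ ∣ Q ∣  ≡⟨ cong₂ (λ s t → s ℕ.+ t ℕ.+ ∣ Q ∣)
                                                          (cong₂ ℕ._+_ (ℤ.abs-* x (+ X)) (ℤ.abs-* P (+ X)))
                                                          (ℤ.abs-* Q y) ⟩
  ∣ x ∣ ℕ.* X ℕ.+ ∣ P ∣ ℕ.* X ℕ.+ ∣ Q ∣ ℕ.* ∣ y ∣ ℕ.+ ∣ Q ∣ ≡⟨ collect (∣ x ∣) (∣ P ∣) (∣ Q ∣) (∣ y ∣) X ⟩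
  (∣ x ∣ ℕ.+ ∣ P ∣) ℕ.* X ℕ.+ ∣ Q ∣ ℕ.* suc ∣ y ∣       <⟨ a+c<X⇒a*X+c<X*X (∣ x ∣ ℕ.+ ∣ P ∣) (∣ Q ∣ ℕ.* suc ∣ y ∣) bound ⟩
  X ℕ.* X                                             ∎
  where
    open ℕ.≤-Reasoning
    collect : ∀ a b c d X → a ℕ.* X ℕ.+ b ℕ.* X ℕ.+ c ℕ.* d ℕ.+ c ≡ (a ℕ.+ b) ℕ.* X ℕ.+ c ℕ.* suc d
    collect = ℕ-Solver.solve-∀

remainder<charPoly : ∀ P Q x y X → ∣ x ∣ ℕ.+ ∣ P ∣ ℕ.+ ∣ Q ∣ ℕ.* suc ∣ y ∣ ℕ.< X →
                     x * + X - Q * y < charPoly P Q (+ X)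
remainder<charPoly P Q x y X bound = begin-strict
  x * + X - Q * y              ≡⟨ split x (+ X) P Q y ⟩
  E + (Q - P * + X)            ≤⟨ ℤ.+-monoˡ-≤ (Q - P * + X) (i≤+∣i∣ E) ⟩
  + ∣ E ∣ + (Q - P * + X)      <⟨ ℤ.+-monoˡ-< (Q - P * + X) (+<+ (∣xX+PX-Qy-Q∣<X*X P Q x y X bound)) ⟩
  + (X ℕ.* X) + (Q - P * + X)  ≡⟨ cong (_+ (Q - P * + X)) (ℤ.pos-* X X) ⟩
  + X * + X + (Q - P * + X)    ≡⟨ join (+ X) P Q ⟩
  charPoly P Q (+ X)           ∎
  where
    open ℤ.≤-Reasoning
    E : ℤ
    E = x * + X + P * + X - Q * y - Q
    split : ∀ a b p q c → a * b - q * c ≡ a * b + p * b - q * c - q + (q - p * b)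
    split = solve-∀
    join : ∀ b p q → b * b + (q - p * b) ≡ b * (b * + 1) - p * b + q
    join = solve-∀

module LinearRecurrence (P Q : ℤ) (W : ℕ → ℤ)
                        (W-rec : ∀ k → W (suc (suc k)) ≡ P * W (suc k) - Q * W k) where

  horner : ℤ → ℕ → ℤ
  horner B zero    = W 0
  horner B (suc n) = horner B n * B + W (suc n)

  numerator : ℤ → ℕ → ℤ
  numerator B n = W 0 * B ^ suc (suc n) + (W 1 - P * W 0) * B ^ suc n

  remainder : ℤ → ℕ → ℤ
  remainder B n = W (suc n) * B - Q * W n

  numerator≡horner*charPoly+remainder : ∀ B n →
    numerator B n ≡ horner B n * charPoly P Q B + remainder B n
  numerator≡horner*charPoly+remainder B zero = base B P Q (W 0) (W 1)
    where
      base : ∀ b p q w₀ w₁ → w₀ * (b * (b * + 1)) + (w₁ - p * w₀) * (b * + 1)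
                           ≡ w₀ * (b * (b * + 1) - p * b + q) + (w₁ * b - q * w₀)
      base = solve-∀
  numerator≡horner*charPoly+remainder B (suc n) = begin
    numerator B (suc n)                                    ≡⟨ scale (W 0) (W 1 - P * W 0) B (B ^ suc (suc n)) (B ^ suc n) ⟩
    numerator B n * B                                      ≡⟨ cong (_* B) (numerator≡horner*charPoly+remainder B n) ⟩
    (horner B n * charPoly P Q B + remainder B n) * B      ≡⟨ step (horner B n) B P Q (W n) (W (suc n)) ⟩
    horner B (suc n) * charPoly P Q B + ((P * W (suc n) - Q * W n) * B - Q * W (suc n))
      ≡⟨ cong (λ w → horner B (suc n) * charPoly P Q B + (w * B - Q * W (suc n))) (W-rec n) ⟨
    horner B (suc n) * charPoly P Q B + remainder B (suc n) ∎
    where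
      open ≡-Reasoning
      scale : ∀ w₀ c b u v → w₀ * (b * u) + c * (b * v) ≡ (w₀ * u + c * v) * b
      scale = solve-∀
      step : ∀ h b p q w₀ w₁ → (h * (b * (b * + 1) - p * b + q) + (w₁ * b - q * w₀)) * b
                              ≡ (h * b + w₁) * (b * (b * + 1) - p * b + q) + ((p * w₁ - q * w₀) * b - q * w₁)
      step = solve-∀

  ∣W[2+k]∣≤ : ∀ k → ∣ W (suc (suc k)) ∣ ℕ.≤ ∣ P ∣ ℕ.* ∣ W (suc k) ∣ ℕ.+ ∣ Q ∣ ℕ.* ∣ W k ∣
  ∣W[2+k]∣≤ k = begin
    ∣ W (suc (suc k)) ∣                   ≡⟨ cong ∣_∣ (W-rec k) ⟩
    ∣ P * W (suc k) - Q * W k ∣           ≤⟨ ℤ.∣i-j∣≤∣i∣+∣j∣ (P * W (suc k)) (Q * W k) ⟩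
    ∣ P * W (suc k) ∣ ℕ.+ ∣ Q * W k ∣     ≡⟨ cong₂ ℕ._+_ (ℤ.abs-* P (W (suc k))) (ℤ.abs-* Q (W k)) ⟩
    ∣ P ∣ ℕ.* ∣ W (suc k) ∣ ℕ.+ ∣ Q ∣ ℕ.* ∣ W k ∣ ∎
    where open ℕ.≤-Reasoning

  ∣W∣≤c*M^k : ∀ {c M} .{{_ : NonZero M}} → ∣ P ∣ ℕ.+ ∣ Q ∣ ℕ.≤ M →
              ∣ W 0 ∣ ℕ.≤ c → ∣ W 1 ∣ ℕ.≤ c ℕ.* M → ∀ k → ∣ W k ∣ ℕ.≤ c ℕ.* M ℕ.^ k
  ∣W∣≤c*M^k {c} {M} p+q≤M ∣W₀∣≤c ∣W₁∣≤cM k = proj₁ (consecutive k)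
    where
      open ℕ.≤-Reasoning
      p q : ℕ
      p = ∣ P ∣
      q = ∣ Q ∣
      consecutive : ∀ k → ∣ W k ∣ ℕ.≤ c ℕ.* M ℕ.^ k × ∣ W (suc k) ∣ ℕ.≤ c ℕ.* M ℕ.^ suc k
      consecutive zero    = subst (∣ W 0 ∣ ℕ.≤_) (sym (ℕ.*-identityʳ c)) ∣W₀∣≤c ,
                            subst (λ t → ∣ W 1 ∣ ℕ.≤ c ℕ.* t) (sym (ℕ.*-identityʳ M)) ∣W₁∣≤cM
      consecutive (suc k) with consecutive k
      ... | ∣Wₖ∣≤ , ∣Wₖ₊₁∣≤ = ∣Wₖ₊₁∣≤ , (begin
        ∣ W (suc (suc k)) ∣                              ≤⟨ ∣W[2+k]∣≤ k ⟩
        p ℕ.* ∣ W (suc k) ∣ ℕ.+ q ℕ.* ∣ W k ∣             ≤⟨ ℕ.+-mono-≤ (ℕ.*-monoʳ-≤ p ∣Wₖ₊₁∣≤) (ℕ.*-monoʳ-≤ q ∣Wₖ∣≤′) ⟩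
        p ℕ.* (c ℕ.* M ℕ.^ suc k) ℕ.+ q ℕ.* (c ℕ.* M ℕ.^ suc k) ≡⟨ ℕ.*-distribʳ-+ (c ℕ.* M ℕ.^ suc k) p q ⟨
        (p ℕ.+ q) ℕ.* (c ℕ.* M ℕ.^ suc k)                ≤⟨ ℕ.*-monoˡ-≤ (c ℕ.* M ℕ.^ suc k) p+q≤M ⟩
        M ℕ.* (c ℕ.* M ℕ.^ suc k)                        ≡⟨ x∙yz≈y∙xz M c (M ℕ.^ suc k) ⟩
        c ℕ.* M ℕ.^ suc (suc k)                          ∎)
        where
          ∣Wₖ∣≤′ : ∣ W k ∣ ℕ.≤ c ℕ.* M ℕ.^ suc k
          ∣Wₖ∣≤′ = ℕ.≤-trans ∣Wₖ∣≤ (ℕ.*-monoʳ-≤ c (ℕ.^-monoʳ-≤ M (ℕ.n≤1+n k)))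

  module _ (W-nonneg : ∀ k → + 0 ≤ W k) where

    horner-nonneg : ∀ X n → + 0 ≤ horner (+ X) n
    horner-nonneg X zero    = W-nonneg 0
    horner-nonneg X (suc n) =
      ℤ.+-mono-≤ (ℤ.*-monoʳ-≤-nonNeg (+ X) (horner-nonneg X n)) (W-nonneg (suc n))

    horner-digit : ∀ X m → ∣ W (suc m) ∣ ℕ.< X →
                   ∣ W (suc (suc m)) ∣ ℕ.+ ∣ P ∣ ℕ.+ ∣ Q ∣ ℕ.* suc ∣ W (suc m) ∣ ℕ.< X →
                   (+ 0 < charPoly P Q (+ X)) ×
                   (W (suc m) ≡ modNat (floorDiv (numerator (+ X) (suc m)) (charPoly P Q (+ X))) X)
    horner-digit X m ∣Wₙ∣<X bound = ℤ.≤-<-trans R≥0 R<D , sym (begin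
      modNat (floorDiv (numerator B n) (charPoly P Q B)) X
        ≡⟨ cong (λ a → modNat a X)
             (floorDiv-quotient (numerator≡horner*charPoly+remainder B n) (horner-nonneg X n) R≥0 R<D) ⟩
      modNat (horner B m * B + W n) X
        ≡⟨ modNat-digit X (horner-nonneg X m) (W-nonneg n) Wₙ<X ⟩
      W n ∎)
      where
        open ≡-Reasoning
        n : ℕ
        n = suc m
        B : ℤ
        B = + X
        ∣Q∣∣Wₙ∣≤X : ∣ Q ∣ ℕ.* ∣ W n ∣ ℕ.≤ X
        ∣Q∣∣Wₙ∣≤X = ℕ.≤-trans (ℕ.*-monoʳ-≤ ∣ Q ∣ (ℕ.n≤1+n _)) (ℕ.≤-trans (ℕ.m≤n+m _ _) (ℕ.<⇒≤ bound))
        R≥0 : + 0 ≤ remainder B n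
        R≥0 = remainder-nonneg P Q (W (suc n)) (W n) X (W-nonneg (suc n))
                (subst (+ 0 ≤_) (W-rec n) (W-nonneg (suc (suc n)))) ∣Q∣∣Wₙ∣≤X
        R<D : remainder B n < charPoly P Q B
        R<D = remainder<charPoly P Q (W (suc n)) (W n) X bound
        Wₙ<X : W n < B
        Wₙ<X = subst (_< B) (ℤ.0≤i⇒+∣i∣≡i (W-nonneg n)) (+<+ ∣Wₙ∣<X)

    base-expansion : ∀ {M b} → ∣ P ∣ ℕ.+ ∣ Q ∣ ℕ.< M → ∣ W 0 ∣ ℕ.≤ 2 → ∣ W 1 ∣ ℕ.≤ 2 ℕ.* M →
      5 ℕ.* (M ℕ.* M) ℕ.≤ b → ∀ m → let n = suc m in
      (+ 0 < (+ b) ^ (2 ℕ.* n) - P * (+ b) ^ n + Q) ×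
      (W n ≡ modNat (floorDiv (W 0 * (+ b) ^ (n ℕ.* n ℕ.+ 2 ℕ.* n) + (W 1 - P * W 0) * (+ b) ^ (n ℕ.* n ℕ.+ n))
                              ((+ b) ^ (2 ℕ.* n) - P * (+ b) ^ n + Q))
                     (b ℕ.^ n))
    base-expansion {M} {b} p+q<M ∣W₀∣≤2 ∣W₁∣≤2M 5M²≤b m =
      subst₂ (λ a D → (+ 0 < D) × (W n ≡ modNat (floorDiv a D) X)) (sym numerator-in-b) (sym charPoly-in-b)
        (horner-digit X m (proj₁ bounds) (proj₂ bounds))
      where
        n X : ℕ
        n = suc m
        X = b ℕ.^ n
        instance
          M≢0 : NonZero M
          M≢0 = ℕ.>-nonZero (ℕ.≤-<-trans ℕ.z≤n p+q<M)
        ∣W∣≤ : ∀ k → ∣ W k ∣ ℕ.≤ 2 ℕ.* M ℕ.^ k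
        ∣W∣≤ = ∣W∣≤c*M^k (ℕ.<⇒≤ p+q<M) ∣W₀∣≤2 ∣W₁∣≤2M
        bounds : ∣ W n ∣ ℕ.< X × ∣ W (suc n) ∣ ℕ.+ ∣ P ∣ ℕ.+ ∣ Q ∣ ℕ.* suc ∣ W n ∣ ℕ.< X
        bounds = digit-bounds {{M≢0}} {{ℕ.m^n≢0 M n}} p+q<M (∣W∣≤ n) (∣W∣≤ (suc n)) (c*M^[2+m]≤b^[1+m] 5 5M²≤b m)
        charPoly-in-b : (+ b) ^ (2 ℕ.* n) - P * (+ b) ^ n + Q ≡ charPoly P Q (+ X)
        charPoly-in-b = cong₂ (λ u v → u - P * v + Q)
                          (trans (cong ((+ b) ^_) (ℕ.*-comm 2 n)) (pos-^-* b n 2)) (pos-^ b n)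
        n*n+2*n≡n*[2+n] : ∀ n → n ℕ.* n ℕ.+ 2 ℕ.* n ≡ n ℕ.* suc (suc n)
        n*n+2*n≡n*[2+n] = ℕ-Solver.solve-∀
        n*n+n≡n*[1+n] : ∀ n → n ℕ.* n ℕ.+ n ≡ n ℕ.* suc n
        n*n+n≡n*[1+n] = ℕ-Solver.solve-∀
        numerator-in-b : W 0 * (+ b) ^ (n ℕ.* n ℕ.+ 2 ℕ.* n) + (W 1 - P * W 0) * (+ b) ^ (n ℕ.* n ℕ.+ n)
                         ≡ numerator (+ X) n
        numerator-in-b = cong₂ (λ u v → W 0 * u + (W 1 - P * W 0) * v)
                           (trans (cong ((+ b) ^_) (n*n+2*n≡n*[2+n] n)) (pos-^-* b n (suc (suc n))))
                           (trans (cong ((+ b) ^_) (n*n+n≡n*[1+n] n)) (pos-^-* b n (suc n)))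

corollary6p4 : (P Q : ℤ) → (+ 4) * Q ≢ P * P → (+ 4) * Q ≢ + 0
  → (∀ n → + 0 ≤ U P Q n) → (∀ n → + 0 ≤ V P Q n)
  → Σ ℕ (λ B → (b : ℕ) → B ℕ.≤ b → 2 ℕ.≤ b → (n : ℕ) → 1 ℕ.≤ n
    → (+ 0 < (+ b) ^ (2 ℕ.* n) - P * (+ b) ^ n + Q)
    × (U P Q n ≡ modNat (floorDiv ((+ b) ^ (n ℕ.* n ℕ.+ n)) ((+ b) ^ (2 ℕ.* n) - P * (+ b) ^ n + Q)) (b ℕ.^ n))
    × (V P Q n ≡ modNat (floorDiv ((+ 2) * (+ b) ^ (n ℕ.* n ℕ.+ 2 ℕ.* n) - P * (+ b) ^ (n ℕ.* n ℕ.+ n)) ((+ b) ^ (2 ℕ.* n) - P * (+ b) ^ n + Q)) (b ℕ.^ n)))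
corollary6p4 P Q _ _ U≥0 V≥0 = 5 ℕ.* (M ℕ.* M) , λ where
    _ _       _ zero    ()
    b 5M²≤b _ (suc m) _ →
      let n = suc m
          D = (+ b) ^ (2 ℕ.* n) - P * (+ b) ^ n + Q
          x = (+ b) ^ (n ℕ.* n ℕ.+ 2 ℕ.* n)
          y = (+ b) ^ (n ℕ.* n ℕ.+ n)
          D>0 , U-digit = LU.base-expansion U≥0 p+q<M ℕ.z≤n (ℕ.s≤s ℕ.z≤n) 5M²≤b m
          _   , V-digit = LV.base-expansion V≥0 p+q<M ℕ.≤-refl ∣P∣≤2M 5M²≤b m
      in D>0 ,
         subst (λ a → U P Q n ≡ modNat (floorDiv a D) (b ℕ.^ n)) (U-numerator P x y) U-digit ,
         subst (λ a → V P Q n ≡ modNat (floorDiv a D) (b ℕ.^ n)) (V-numerator P x y) V-digit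
  where
    M : ℕ
    M = suc (∣ P ∣ ℕ.+ ∣ Q ∣)
    p+q<M : ∣ P ∣ ℕ.+ ∣ Q ∣ ℕ.< M
    p+q<M = ℕ.n<1+n _
    ∣P∣≤2M : ∣ P ∣ ℕ.≤ 2 ℕ.* M
    ∣P∣≤2M = ℕ.≤-trans (ℕ.<⇒≤ (ℕ.≤-<-trans (ℕ.m≤m+n ∣ P ∣ ∣ Q ∣) p+q<M)) (ℕ.m≤n*m M 2)
    module LU = LinearRecurrence P Q (U P Q) (λ _ → refl)
    module LV = LinearRecurrence P Q (V P Q) (λ _ → refl)
    U-numerator : ∀ p x y → + 0 * x + (+ 1 - p * + 0) * y ≡ y
    U-numerator = solve-∀
    V-numerator : ∀ p x y → + 2 * x + (p - p * + 2) * y ≡ + 2 * x - p * y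
    V-numerator = solve-∀
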